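{- If $r,s\ge 2$, then $\mathrm{gp}^-(K_r\,\square\, K_s)=\min\{r,s\}$.
   Context: $K_r\,\square\,K_s$ is the Cartesian product of complete graphs: vertices are pairs $(i,j)$, and $(i,j)\sim(i',j')$ iff ($i=i'$ and $j\ne j'$) or ($j=j'$ and $i\ne i'$). A set $S$ of vertices of a connected graph $G$ is a general position set if no shortest path contains three or more vertices of $S$; it is maximal if not properly contained in another general position set; $\mathrm{gp}^-(G)$ is the number of vertices in a smallest maximal general position set. -}

module Defs where

open import Data.Nat using (ℕ; zero; suc; _≤_)
open import Data.Fin using (Fin)
open import Data.Product using (_×_; _,_; Σ; ∃; ∃-syntax; proj₁; proj₂)
open import Data.Sum using (_⊎_)
open import Data.List using (List; []; _∷_; length)
open import Data.List.Membership.Propositional using (_∈_; _∉_)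
open import Data.List.Relation.Unary.Unique.Propositional using (Unique)
open import Relation.Binary.PropositionalEquality using (_≡_; _≢_)
open import Relation.Nullary using (¬_)

record Graph : Set₁ where
  field
    V   : Set
    Adj : V → V → Set
open Graph public

KK : ℕ → ℕ → Graph
KK r s = record
  { V   = Fin r × Fin s
  ; Adj = λ { (i , j) (i' , j') → (i ≡ i' × j ≢ j') ⊎ (j ≡ j' × i ≢ i') } }

module _ (G : Graph) where

  data Walk : V G → V G → Set where
    [_] : (v : V G) → Walk v v
    step : {v w : V G} (u : V G) → Adj G u v → Walk v w → Walk u w

  walkLength : {u w : V G} → Walk u w → ℕ
  walkLength [ v ]          = 0
  walkLength (step u _ p)   = suc (walkLength p)

  vertices : {u w : V G} → Walk u w → List (V G)
  vertices [ v ]          = v ∷ []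
  vertices (step u _ p)   = u ∷ vertices p

  IsShortest : {u w : V G} → Walk u w → Set
  IsShortest {u} {w} p = (q : Walk u w) → walkLength p ≤ walkLength q

  -- Finite vertex sets are represented as duplicate-free lists.
  _⊆_ : List (V G) → List (V G) → Set
  S ⊆ T = ∀ {x} → x ∈ S → x ∈ T

  GeneralPosition : List (V G) → Set
  GeneralPosition S =
    ¬ (Σ (V G) λ u → Σ (V G) λ w → Σ (Walk u w) λ p →
         IsShortest p ×
         (∃[ x ] ∃[ y ] ∃[ z ]
            (x ≢ y × x ≢ z × y ≢ z ×
             x ∈ S × y ∈ S × z ∈ S ×
             x ∈ vertices p × y ∈ vertices p × z ∈ vertices p)))

  MaximalGP : List (V G) → Set
  MaximalGP S =
    Unique S × GeneralPosition S ×
    ((T : List (V G)) → Unique T → GeneralPosition T → S ⊆ T → T ⊆ S)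

  IsGpMinus : ℕ → Set
  IsGpMinus m =
    (Σ (List (V G)) λ S → MaximalGP S × length S ≡ m) ×
    ((S : List (V G)) → MaximalGP S → m ≤ length S)

-- Any two vertices of K_r □ K_s are at distance at most 2, so a vertex set S is
-- in general position exactly when it contains no induced path u – m – w.
-- A line {(i , c) | i} is a clique, hence in general position, and it is
-- maximal: a vertex (a , b) off the line is the end of the induced path
-- (a , b) – (a , c) – (a' , c) for any a' ≢ a.  Conversely, if |S| < min(r, s)
-- then some row a and some column b miss S, so (a , b) has no neighbour in S
-- and can be added to S without creating an induced path.

module Submission where

open import Defs
open import Data.Nat using (ℕ; _≤_; _<_; _⊓_; s≤s; z≤n)
open import Data.Nat.Properties using (≤-total; ≤-trans; <-≤-trans; ≮⇒≥; m≤n⇒m⊓n≡m; m≥n⇒m⊓n≡n; m⊓n≤m; m⊓n≤n)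
open import Data.Fin using (Fin; zero; suc; _≟_)
open import Data.Fin.Properties using (¬∀⟶∃¬; pigeonhole; <⇒≢)
open import Data.Product using (_×_; _,_; ∃; ∃-syntax; ∃₂; proj₁; proj₂)
open import Data.Sum using (_⊎_; inj₁; inj₂)
open import Data.Empty using (⊥; ⊥-elim)
open import Data.List using (List; []; _∷_; _∷ʳ_; length; map; tabulate; lookup)
open import Data.List.Properties using (length-map; length-tabulate)
open import Data.List.Membership.Propositional using (_∈_; _∉_)
open import Data.List.Membership.Propositional.Properties using (∈-++⁺ˡ; ∈-++⁺ʳ; ∈-map⁺; ∈-tabulate⁺; ∈-tabulate⁻)
open import Data.List.Relation.Unary.Any using (here; there; index; any?)
open import Data.List.Relation.Unary.Any.Properties using (lookup-index)
open import Data.List.Relation.Unary.All as All using (_∷_; [])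
open import Data.List.Relation.Unary.All.Properties using (¬Any⇒All¬)
open import Data.List.Relation.Unary.AllPairs using (_∷_)
open import Data.List.Relation.Unary.Unique.Propositional using (Unique)
open import Data.List.Relation.Unary.Unique.Propositional.Properties using (tabulate⁺)
open import Relation.Binary.PropositionalEquality using (_≡_; _≢_; refl; sym; trans; cong; subst)
open import Relation.Nullary using (¬_; yes; no)

∈-rotate : {A : Set} {v a : A} {xs : List A} → v ∈ a ∷ xs → v ∈ xs ∷ʳ a
∈-rotate {xs = xs} (here v≡a) = ∈-++⁺ʳ xs (here v≡a)
∈-rotate (there v∈xs) = ∈-++⁺ˡ v∈xs

distinct-∉-singleton : {A : Set} {x y a : A} → x ≢ y → x ∈ a ∷ [] → y ∈ a ∷ [] → ⊥
distinct-∉-singleton x≢y (here x≡a) (here y≡a) = x≢y (trans x≡a (sym y≡a))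

module _ {A : Set} {x y z : A} (x≢y : x ≢ y) (x≢z : x ≢ z) (y≢z : y ≢ z) where

  distinct-∉-pair : ∀ {a b} → x ∈ a ∷ b ∷ [] → y ∈ a ∷ b ∷ [] → z ∈ a ∷ b ∷ [] → ⊥
  distinct-∉-pair (here x≡a) (here y≡a) _ = x≢y (trans x≡a (sym y≡a))
  distinct-∉-pair (here x≡a) _ (here z≡a) = x≢z (trans x≡a (sym z≡a))
  distinct-∉-pair _ (here y≡a) (here z≡a) = y≢z (trans y≡a (sym z≡a))
  distinct-∉-pair (there (here x≡b)) (there (here y≡b)) _ = x≢y (trans x≡b (sym y≡b))
  distinct-∉-pair (there (here x≡b)) _ (there (here z≡b)) = x≢z (trans x≡b (sym z≡b))
  distinct-∉-pair _ (there (here y≡b)) (there (here z≡b)) = y≢z (trans y≡b (sym z≡b))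
  distinct-∉-pair (there (there ())) _ _
  distinct-∉-pair _ (there (there ())) _
  distinct-∉-pair _ _ (there (there ()))

  head-∈-distinct : ∀ {a b c} → x ∈ a ∷ b ∷ c ∷ [] → y ∈ a ∷ b ∷ c ∷ [] → z ∈ a ∷ b ∷ c ∷ [] →
                    a ∈ x ∷ y ∷ z ∷ []
  head-∈-distinct (here x≡a) _ _ = here (sym x≡a)
  head-∈-distinct _ (here y≡a) _ = there (here (sym y≡a))
  head-∈-distinct _ _ (here z≡a) = there (there (here (sym z≡a)))
  head-∈-distinct (there x∈) (there y∈) (there z∈) = ⊥-elim (distinct-∉-pair x∈ y∈ z∈)

  triple-⊆-distinct : ∀ {a b c v} → x ∈ a ∷ b ∷ c ∷ [] → y ∈ a ∷ b ∷ c ∷ [] → z ∈ a ∷ b ∷ c ∷ [] →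
                      v ∈ a ∷ b ∷ c ∷ [] → v ∈ x ∷ y ∷ z ∷ []
  triple-⊆-distinct x∈ y∈ z∈ (here refl) = head-∈-distinct x∈ y∈ z∈
  triple-⊆-distinct x∈ y∈ z∈ (there (here refl)) =
    head-∈-distinct (∈-rotate x∈) (∈-rotate y∈) (∈-rotate z∈)
  triple-⊆-distinct x∈ y∈ z∈ (there (there (here refl))) =
    head-∈-distinct (∈-rotate (∈-rotate x∈)) (∈-rotate (∈-rotate y∈)) (∈-rotate (∈-rotate z∈))

pigeonhole-∉ : ∀ {n} (xs : List (Fin n)) → length xs < n → ∃ λ a → a ∉ xs
pigeonhole-∉ {n} xs |xs|<n = ¬∀⟶∃¬ n (_∈ xs) (λ a → any? (a ≟_) xs) λ all∈ →
  let (i , j , i<j , same-index) = pigeonhole |xs|<n (λ a → index (all∈ a))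
  in <⇒≢ i<j (trans (lookup-index (all∈ i))
                (trans (cong (lookup xs) same-index) (sym (lookup-index (all∈ j)))))

module _ (G : Graph) where

  Irreflexive : Set
  Irreflexive = ∀ {v} → ¬ Adj G v v

  Diameter≤2 : Set
  Diameter≤2 = ∀ u w → ∃ λ (q : Walk G u w) → walkLength G q ≤ 2

  -- u – m – w is an induced path, i.e. a geodesic of length two.
  P₃ : V G → V G → V G → Set
  P₃ u m w = Adj G u m × Adj G m w × u ≢ w × ¬ Adj G u w

  ContainsP₃ : List (V G) → Set
  ContainsP₃ S = ∃[ u ] ∃[ m ] ∃[ w ] (u ∈ S × m ∈ S × w ∈ S × P₃ u m w)

  Clique : List (V G) → Set
  Clique S = ∀ {u w} → u ∈ S → w ∈ S → u ≢ w → Adj G u w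

  P₃-Covered : List (V G) → Set
  P₃-Covered S = ∀ v → v ∈ S ⊎ ∃₂ λ m w → m ∈ S × w ∈ S × P₃ v m w

  Isolated : V G → List (V G) → Set
  Isolated v S = ∀ {x} → x ∈ S → ¬ Adj G x v × ¬ Adj G v x

  P₃-isShortest : ∀ {u m w} (u–m : Adj G u m) (m–w : Adj G m w) → u ≢ w → ¬ Adj G u w →
                  IsShortest G (step u u–m (step m m–w [ w ]))
  P₃-isShortest _ _ u≢w _ [ _ ] = ⊥-elim (u≢w refl)
  P₃-isShortest _ _ _ u≁w (step _ u–w [ _ ]) = ⊥-elim (u≁w u–w)
  P₃-isShortest _ _ _ _ (step _ _ (step _ _ _)) = s≤s (s≤s z≤n)

  isShortest⇒P₃ : ∀ {u m w} (u–m : Adj G u m) (m–w : Adj G m w) →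
                  IsShortest G (step u u–m (step m m–w [ w ])) → P₃ u m w
  isShortest⇒P₃ {u} {m} {w} u–m m–w shortest = u–m , m–w , u≢w , u≁w
    where
    u≢w : u ≢ w
    u≢w refl with shortest [ u ]
    ... | ()
    u≁w : ¬ Adj G u w
    u≁w u–w with shortest (step u u–w [ w ])
    ... | s≤s ()

  module _ (irreflexive : Irreflexive) where

    containsP₃⇒¬gp : ∀ {S} → ContainsP₃ S → ¬ GeneralPosition G S
    containsP₃⇒¬gp (u , m , w , u∈S , m∈S , w∈S , u–m , m–w , u≢w , u≁w) gp =
      gp (u , w , step u u–m (step m m–w [ w ]) , P₃-isShortest u–m m–w u≢w u≁w ,
          u , m , w , u≢m , u≢w , m≢w , u∈S , m∈S , w∈S ,
          here refl , there (here refl) , there (there (here refl)))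
      where
      u≢m : u ≢ m
      u≢m refl = irreflexive u–m
      m≢w : m ≢ w
      m≢w refl = irreflexive m–w

    P₃-covered⇒closed : ∀ {S} → P₃-Covered S →
                        ∀ {T} → GeneralPosition G T → _⊆_ G S T → _⊆_ G T S
    P₃-covered⇒closed covered gpT S⊆T {v} v∈T with covered v
    ... | inj₁ v∈S = v∈S
    ... | inj₂ (m , w , m∈S , w∈S , path) =
      ⊥-elim (containsP₃⇒¬gp (v , m , w , v∈T , S⊆T m∈S , S⊆T w∈S , path) gpT)

    ¬containsP₃-∷-isolated : ∀ {v S} → ¬ ContainsP₃ S → Isolated v S → ¬ ContainsP₃ (v ∷ S)
    ¬containsP₃-∷-isolated _ _ (_ , _ , _ , here refl , here refl , _ , u–m , _) = irreflexive u–m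
    ¬containsP₃-∷-isolated _ isolated (_ , _ , _ , there u∈S , here refl , _ , u–m , _) =
      proj₁ (isolated u∈S) u–m
    ¬containsP₃-∷-isolated _ isolated (_ , _ , _ , here refl , there m∈S , _ , u–m , _) =
      proj₂ (isolated m∈S) u–m
    ¬containsP₃-∷-isolated _ isolated (_ , _ , _ , there _ , there m∈S , here refl , _ , m–w , _) =
      proj₁ (isolated m∈S) m–w
    ¬containsP₃-∷-isolated noP₃ _ (u , m , w , there u∈S , there m∈S , there w∈S , path) =
      noP₃ (u , m , w , u∈S , m∈S , w∈S , path)

  module _ (diameter≤2 : Diameter≤2) where

    ¬containsP₃⇒gp : ∀ {S} → ¬ ContainsP₃ S → GeneralPosition G S
    ¬containsP₃⇒gp {S} noP₃
      (u , w , p , p-shortest , x , y , z , x≢y , x≢z , y≢z , x∈S , y∈S , z∈S , x∈p , y∈p , z∈p) =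
      short-geodesic p p-shortest (≤-trans (p-shortest q) |q|≤2) x∈p y∈p z∈p
      where
      q = proj₁ (diameter≤2 u w)
      |q|≤2 = proj₂ (diameter≤2 u w)
      short-geodesic : ∀ {u w} (p : Walk G u w) → IsShortest G p → walkLength G p ≤ 2 →
                       x ∈ vertices G p → y ∈ vertices G p → z ∈ vertices G p → ⊥
      short-geodesic [ _ ] _ _ x∈p y∈p _ = distinct-∉-singleton x≢y x∈p y∈p
      short-geodesic (step _ _ [ _ ]) _ _ x∈p y∈p z∈p = distinct-∉-pair x≢y x≢z y≢z x∈p y∈p z∈p
      short-geodesic (step u u–m (step m m–w [ w ])) shortest _ x∈p y∈p z∈p =
        noP₃ (u , m , w , on-p⇒∈S (here refl) , on-p⇒∈S (there (here refl)) ,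
              on-p⇒∈S (there (there (here refl))) , isShortest⇒P₃ u–m m–w shortest)
        where
        on-p⇒∈S : ∀ {v} → v ∈ u ∷ m ∷ w ∷ [] → v ∈ S
        on-p⇒∈S v∈p = All.lookup (x∈S ∷ y∈S ∷ z∈S ∷ []) (triple-⊆-distinct x≢y x≢z y≢z x∈p y∈p z∈p v∈p)
      short-geodesic (step _ _ (step _ _ (step _ _ _))) _ (s≤s (s≤s ())) _ _ _

    module _ (irreflexive : Irreflexive) where

      clique-maximalGP : ∀ {S} → Unique S → Clique S → P₃-Covered S → MaximalGP G S
      clique-maximalGP unique clique covered =
        unique ,
        ¬containsP₃⇒gp (λ (_ , _ , _ , u∈S , _ , w∈S , _ , _ , u≢w , u≁w) → u≁w (clique u∈S w∈S u≢w)) ,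
        λ T _ gpT → P₃-covered⇒closed irreflexive covered gpT

      maximalGP⇒¬isolated-outsider : ∀ {v S} → MaximalGP G S → v ∉ S → ¬ Isolated v S
      maximalGP⇒¬isolated-outsider {v} {S} (unique , gpS , maximal) v∉S isolated =
        v∉S (maximal (v ∷ S) (¬Any⇒All¬ S v∉S ∷ unique) gp∷ there (here refl))
        where
        gp∷ : GeneralPosition G (v ∷ S)
        gp∷ = ¬containsP₃⇒gp (¬containsP₃-∷-isolated irreflexive
                               (λ path → containsP₃⇒¬gp irreflexive path gpS) isolated)

another : ∀ {n} → 2 ≤ n → (a : Fin n) → ∃ λ b → a ≢ b
another (s≤s (s≤s _)) zero = suc zero , λ ()
another (s≤s (s≤s _)) (suc _) = zero , λ ()

module _ {r s : ℕ} where

  KK-irreflexive : Irreflexive (KK r s)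
  KK-irreflexive (inj₁ (_ , j≢j)) = j≢j refl
  KK-irreflexive (inj₂ (_ , i≢i)) = i≢i refl

  KK-diameter≤2 : Diameter≤2 (KK r s)
  KK-diameter≤2 (i , j) (i' , j') with i ≟ i' | j ≟ j'
  ... | yes refl | yes refl = [ _ ] , z≤n
  ... | yes refl | no j≢j' = step _ (inj₁ (refl , j≢j')) [ _ ] , s≤s z≤n
  ... | no i≢i' | yes refl = step _ (inj₂ (refl , i≢i')) [ _ ] , s≤s z≤n
  ... | no i≢i' | no j≢j' =
    step _ (inj₁ (refl , j≢j')) (step (i , j') (inj₂ (refl , i≢i')) [ _ ]) , s≤s (s≤s z≤n)

  column : Fin s → List (Fin r × Fin s)
  column c = tabulate (_, c)

  row : Fin r → List (Fin r × Fin s)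
  row a = tabulate (a ,_)

  column-maximalGP : 2 ≤ r → (c : Fin s) → MaximalGP (KK r s) (column c)
  column-maximalGP 2≤r c =
    clique-maximalGP (KK r s) KK-diameter≤2 KK-irreflexive (tabulate⁺ (cong proj₁)) clique covered
    where
    clique : Clique (KK r s) (column c)
    clique u∈ w∈ u≢w with ∈-tabulate⁻ u∈ | ∈-tabulate⁻ w∈
    ... | _ , refl | _ , refl = inj₂ (refl , λ i≡i' → u≢w (cong (_, c) i≡i'))
    covered : P₃-Covered (KK r s) (column c)
    covered (a , b) with b ≟ c
    ... | yes refl = inj₁ (∈-tabulate⁺ a)
    ... | no b≢c =
      let (a' , a≢a') = another 2≤r a in
      inj₂ ((a , c) , (a' , c) , ∈-tabulate⁺ a , ∈-tabulate⁺ a' ,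
            inj₁ (refl , b≢c) , inj₂ (refl , a≢a') , (λ v≡w → b≢c (cong proj₂ v≡w)) ,
            λ { (inj₁ (a≡a' , _)) → a≢a' a≡a' ; (inj₂ (b≡c , _)) → b≢c b≡c })

  row-maximalGP : 2 ≤ s → (a : Fin r) → MaximalGP (KK r s) (row a)
  row-maximalGP 2≤s a =
    clique-maximalGP (KK r s) KK-diameter≤2 KK-irreflexive (tabulate⁺ (cong proj₂)) clique covered
    where
    clique : Clique (KK r s) (row a)
    clique u∈ w∈ u≢w with ∈-tabulate⁻ u∈ | ∈-tabulate⁻ w∈
    ... | _ , refl | _ , refl = inj₁ (refl , λ j≡j' → u≢w (cong (a ,_) j≡j'))
    covered : P₃-Covered (KK r s) (row a)
    covered (b , c) with b ≟ a
    ... | yes refl = inj₁ (∈-tabulate⁺ c)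
    ... | no b≢a =
      let (c' , c≢c') = another 2≤s c in
      inj₂ ((a , c) , (a , c') , ∈-tabulate⁺ c , ∈-tabulate⁺ c' ,
            inj₂ (refl , b≢a) , inj₁ (refl , c≢c') , (λ v≡w → b≢a (cong proj₁ v≡w)) ,
            λ { (inj₁ (b≡a , _)) → b≢a b≡a ; (inj₂ (c≡c' , _)) → c≢c' c≡c' })

  maximalGP-length-≥ : ∀ {S} → MaximalGP (KK r s) S → r ⊓ s ≤ length S
  maximalGP-length-≥ {S} maximal = ≮⇒≥ λ |S|<r⊓s →
    let (a , a∉rows) = pigeonhole-∉ (map proj₁ S)
                         (subst (_< r) (sym (length-map proj₁ S)) (<-≤-trans |S|<r⊓s (m⊓n≤m r s)))
        (b , b∉cols) = pigeonhole-∉ (map proj₂ S)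
                         (subst (_< s) (sym (length-map proj₂ S)) (<-≤-trans |S|<r⊓s (m⊓n≤n r s)))
    in maximalGP⇒¬isolated-outsider (KK r s) KK-diameter≤2 KK-irreflexive maximal
         (λ ab∈S → a∉rows (∈-map⁺ proj₁ ab∈S)) (isolated a∉rows b∉cols)
    where
    ∈-map-≡ : ∀ {B : Set} (f : Fin r × Fin s → B) {x b} → x ∈ S → f x ≡ b → b ∈ map f S
    ∈-map-≡ f x∈S refl = ∈-map⁺ f x∈S
    isolated : ∀ {a b} → a ∉ map proj₁ S → b ∉ map proj₂ S → Isolated (KK r s) (a , b) S
    isolated a∉ b∉ x∈S =
      (λ { (inj₁ (i≡a , _)) → a∉ (∈-map-≡ proj₁ x∈S i≡a) ; (inj₂ (j≡b , _)) → b∉ (∈-map-≡ proj₂ x∈S j≡b) }) ,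
      (λ { (inj₁ (a≡i , _)) → a∉ (∈-map-≡ proj₁ x∈S (sym a≡i)) ; (inj₂ (b≡j , _)) → b∉ (∈-map-≡ proj₂ x∈S (sym b≡j)) })

theorem5p3 : (r s : ℕ) → 2 ≤ r → 2 ≤ s → IsGpMinus (KK r s) (r ⊓ s)
theorem5p3 r s 2≤r@(s≤s _) 2≤s@(s≤s _) with ≤-total r s
... | inj₁ r≤s =
  (column zero , column-maximalGP 2≤r zero , trans (length-tabulate (_, zero)) (sym (m≤n⇒m⊓n≡m r≤s))) ,
  λ _ → maximalGP-length-≥
... | inj₂ s≤r =
  (row zero , row-maximalGP 2≤s zero , trans (length-tabulate (zero ,_)) (sym (m≥n⇒m⊓n≡n s≤r))) ,
  λ _ → maximalGP-length-≥
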